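{- Let $\Delta$ be a stack triangulation with at least $4$ vertices and an ordered outer triangle $(v_1,v_2,v_3)$. Then the root vector of the colored rooted ternary tree $T(\Delta)$ equals the degeneracy vector of $\Delta$.
   Context: A stack triangulation is a plane graph obtained by starting with a triangle and repeatedly applying the growing rule: choose a bounded face $f$, insert a new vertex inside $f$, and join it to the three vertices of $f$. A state is a map $s$ from the vertex set to $\{+,-\}$; an edge $\{x,y\}$ is frustrated if $s(x)=s(y)$; a state is satisfying if every bounded face has exactly one frustrated edge. For a stack triangulation $\Delta$ with ordered outer triangle $(a,b,c)$, its degeneracy vector is $(\Delta[+{+}+],\Delta[+{+}-],\Delta[+{ - }+],\Delta[-{+}+])$ (coordinates indexed $0,\dots,3$), where $\Delta[\phi]$ is the number of satisfying states with $(s(a),s(b),s(c))=\phi$. If $\Delta$ has at least $4$ vertices with ordered outer triangle $(v_1,v_2,v_3)$, let $u$ be the first inserted vertex and let $\Delta^1,\Delta^2,\Delta^3$ be the stack triangulations formed by the vertices on or inside the triangles $v_1v_2u$, $v_2v_3u$, $v_3v_1u$, with ordered outer triangles $(v_1,v_2,u)$, $(v_2,v_3,u)$, $(v_3,v_1,u)$. The tree $T(\Delta)$ is defined recursively: it has a root $r$; for each $j\in\{1,2,3\}$ such that $\Delta^j$ has at least $4$ vertices, $r$ has a child labeled $j$ which is the root of a copy of $T(\Delta^j)$; $r$ has no other children. (Thus $T(\Delta)$ has one vertex per inserted vertex of $\Delta$.) A colored rooted ternary tree is a rooted tree in which every vertex has at most three children, every non-root vertex $x$ has a label $l_x\in\{1,2,3\}$,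 and children of a common vertex have distinct labels. Its root vector is defined recursively; for a vertex $x$ let $\mathbf{x}=(x_0,x_1,x_2,x_3)$ denote the root vector of the subtree of $x$ and its descendants. For the root $v$: Rule 0: if $v$ has no children, $\mathbf{v}=(1,1,1,1)$. Rule 1: if $v$ has exactly one child $a$, then $\mathbf{v}=(a_1,a_0+a_1,a_3,a_2)$, $(a_1,a_3,a_2,a_0+a_1)$ or $(a_1,a_2,a_0+a_1,a_3)$ according as $l_a=1,2,3$. Rule 2: if $v$ has exactly two children, name them $a,b$ so that $(l_a,l_b)\in\{(1,2),(2,3),(3,1)\}$; then $\mathbf{v}=(a_1b_1,\,a_0b_2+a_1b_3,\,a_3b_2,\,a_2b_1+a_3b_0)$ if $l_a=1$; $\mathbf{v}=(a_1b_1,\,a_3b_2,\,a_3b_0+a_2b_1,\,a_1b_3+a_0b_2)$ if $l_a=2$; $\mathbf{v}=(a_1b_1,\,a_3b_0+a_2b_1,\,a_0b_2+a_1b_3,\,a_3b_2)$ if $l_a=3$. Rule 3: if $v$ has three children $a,b,c$ with labels $1,2,3$, then $\mathbf{v}=(a_0b_0c_0+a_1b_1c_1,\,a_0b_2c_3+a_1b_3c_2,\,a_2b_3c_0+a_3b_2c_1,\,a_2b_1c_3+a_3b_0c_2)$. -}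

module Defs where

open import Data.Nat using (ℕ; zero; suc; _+_; _*_; _≤_)
open import Data.Bool using (Bool; true; false; if_then_else_; _∧_)
open import Data.List using (List; []; _∷_; _++_; map; concatMap)
open import Data.Product using (_×_; _,_)
open import Data.Maybe using (Maybe; just; nothing)
open import Relation.Binary.PropositionalEquality using (_≡_)

-- A stack triangulation with ordered outer triangle (a,b,c) is either the
-- bare triangle, or is obtained by inserting a first vertex u inside abc
-- and then (recursively) stack triangulations inside the triangles
-- (a,b,u), (b,c,u), (c,a,u).  This inductive type is exactly this
-- recursive decomposition (cf. the definition of Δ¹, Δ², Δ³).

data Stack : Set where
  triangle : Stack
  insert   : Stack → Stack → Stack → Stack

inner : Stack → ℕ
inner triangle         = 0
inner (insert d₁ d₂ d₃) = suc (inner d₁ + inner d₂ + inner d₃)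

nVerts : Stack → ℕ
nVerts Δ = 3 + inner Δ

-- Vertices are named 0 .. nVerts Δ - 1: the outer vertices a,b,c are
-- 0,1,2; inner vertices are numbered in preorder (first inserted vertex
-- first).  A triangle is a triple of vertex names.

Tri : Set
Tri = ℕ × ℕ × ℕ

facesFrom : Stack → ℕ → ℕ → ℕ → ℕ → List Tri
facesFrom triangle          a b c k = (a , b , c) ∷ []
facesFrom (insert d₁ d₂ d₃) a b c k =
  let u  = k
      k₁ = suc k
      k₂ = k₁ + inner d₁
      k₃ = k₂ + inner d₂
  in facesFrom d₁ a b u k₁ ++ facesFrom d₂ b c u k₂ ++ facesFrom d₃ c a u k₃

boundedFaces : Stack → List Tri
boundedFaces Δ = facesFrom Δ 0 1 2 3

-- States: maps from the vertex set {0,…,n-1} to {+,-}, represented as a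
-- list of length n of booleans (true = +, false = -).

State : Set
State = List Bool

-- value of a state at a vertex (vertices are always in range)
at : State → ℕ → Bool
at []       _       = false
at (x ∷ s)  zero    = x
at (x ∷ s)  (suc i) = at s i

allStates : ℕ → List State
allStates zero    = [] ∷ []
allStates (suc n) = concatMap (λ s → (true ∷ s) ∷ (false ∷ s) ∷ []) (allStates n)

_==ᵇ_ : Bool → Bool → Bool
true  ==ᵇ true  = true
false ==ᵇ false = true
_     ==ᵇ _     = false

frustrated : State → ℕ → ℕ → Bool
frustrated s x y = at s x ==ᵇ at s y

b2n : Bool → ℕ
b2n true  = 1
b2n false = 0

nFrustrated : State → Tri → ℕ
nFrustrated s (x , y , z) =
  b2n (frustrated s x y) + b2n (frustrated s y z) + b2n (frustrated s z x)

isOne : ℕ → Bool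
isOne (suc zero) = true
isOne _          = false

allᵇ : {A : Set} → (A → Bool) → List A → Bool
allᵇ p []       = true
allᵇ p (x ∷ xs) = p x ∧ allᵇ p xs

satisfying : Stack → State → Bool
satisfying Δ s = allᵇ (λ f → isOne (nFrustrated s f)) (boundedFaces Δ)

countᵇ : {A : Set} → (A → Bool) → List A → ℕ
countᵇ p []       = 0
countᵇ p (x ∷ xs) = b2n (p x) + countᵇ p xs

deg : Stack → Bool → Bool → Bool → ℕ
deg Δ φa φb φc =
  countᵇ (λ s → satisfying Δ s ∧ (at s 0 ==ᵇ φa) ∧ (at s 1 ==ᵇ φb) ∧ (at s 2 ==ᵇ φc))
         (allStates (nVerts Δ))

record Quad : Set where
  constructor ⟨_,_,_,_⟩
  field
    q₀ q₁ q₂ q₃ : ℕ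
open Quad public

degVec : Stack → Quad
degVec Δ = ⟨ deg Δ true true true , deg Δ true true false
           , deg Δ true false true , deg Δ false true true ⟩

-- Colored rooted ternary trees: each vertex has, for each label
-- j ∈ {1,2,3}, at most one child labelled j (the j-th argument).

data CTree : Set where
  node : Maybe CTree → Maybe CTree → Maybe CTree → CTree

rootVec : CTree → Quad
rootVec (node nothing nothing nothing) = ⟨ 1 , 1 , 1 , 1 ⟩
rootVec (node (just a) nothing nothing) =
  let ⟨ a₀ , a₁ , a₂ , a₃ ⟩ = rootVec a in ⟨ a₁ , a₀ + a₁ , a₃ , a₂ ⟩
rootVec (node nothing (just a) nothing) =
  let ⟨ a₀ , a₁ , a₂ , a₃ ⟩ = rootVec a in ⟨ a₁ , a₃ , a₂ , a₀ + a₁ ⟩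
rootVec (node nothing nothing (just a)) =
  let ⟨ a₀ , a₁ , a₂ , a₃ ⟩ = rootVec a in ⟨ a₁ , a₂ , a₀ + a₁ , a₃ ⟩
rootVec (node (just a) (just b) nothing) =
  let ⟨ a₀ , a₁ , a₂ , a₃ ⟩ = rootVec a
      ⟨ b₀ , b₁ , b₂ , b₃ ⟩ = rootVec b
  in ⟨ a₁ * b₁ , a₀ * b₂ + a₁ * b₃ , a₃ * b₂ , a₂ * b₁ + a₃ * b₀ ⟩
rootVec (node nothing (just a) (just b)) =
  let ⟨ a₀ , a₁ , a₂ , a₃ ⟩ = rootVec a
      ⟨ b₀ , b₁ , b₂ , b₃ ⟩ = rootVec b
  in ⟨ a₁ * b₁ , a₃ * b₂ , a₃ * b₀ + a₂ * b₁ , a₁ * b₃ + a₀ * b₂ ⟩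
rootVec (node (just b) nothing (just a)) =
  let ⟨ a₀ , a₁ , a₂ , a₃ ⟩ = rootVec a
      ⟨ b₀ , b₁ , b₂ , b₃ ⟩ = rootVec b
  in ⟨ a₁ * b₁ , a₃ * b₀ + a₂ * b₁ , a₀ * b₂ + a₁ * b₃ , a₃ * b₂ ⟩
rootVec (node (just a) (just b) (just c)) =
  let ⟨ a₀ , a₁ , a₂ , a₃ ⟩ = rootVec a
      ⟨ b₀ , b₁ , b₂ , b₃ ⟩ = rootVec b
      ⟨ c₀ , c₁ , c₂ , c₃ ⟩ = rootVec c
  in ⟨ a₀ * b₀ * c₀ + a₁ * b₁ * c₁ , a₀ * b₂ * c₃ + a₁ * b₃ * c₂
     , a₂ * b₃ * c₀ + a₃ * b₂ * c₁ , a₂ * b₁ * c₃ + a₃ * b₀ * c₂ ⟩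

T : Stack → Maybe CTree
T triangle          = nothing
T (insert d₁ d₂ d₃) = just (node (T d₁) (T d₂) (T d₃))

-- Fix the colours x, y, z of the outer triangle and u of the first inserted vertex.  A state
-- is satisfying iff its restrictions to Δ¹, Δ², Δ³ are, and these restrictions overlap only
-- in the colours of outer and apex vertices; hence the number of satisfying extensions of
-- (x, y, z) is  Σᵤ N¹(x,y,u) N²(y,z,u) N³(z,x,u).  Flipping all signs preserves satisfying
-- states, so the eight counts of each Δʲ reduce to its degeneracy vector and the sum becomes
-- Rule 3.  Rules 0–2 are Rule 3 with every missing child replaced by a bare triangle, so the
-- root vector of T(Δ) satisfies the same recursion as the degeneracy vector.

module Submission where

open import Defs
open import Data.Bool using (Bool; true; false; not; _∧_)
open import Data.Bool.Properties using (∧-assoc; ∧-comm; ∧-identityʳ)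
open import Data.List using (List; []; _∷_; _++_; length; concatMap)
open import Data.Maybe using (Maybe; just; nothing)
open import Data.Nat using (ℕ; zero; suc; _+_; _*_; _≤_; _<_; s≤s; z≤n)
open import Data.Nat.Properties
open import Algebra.Properties.CommutativeSemigroup +-commutativeSemigroup using (interchange)
open import Data.Nat.Tactic.RingSolver using (solve)
open import Data.Product using (Σ; _×_; _,_)
open import Function using (_∘_)
open import Relation.Binary.PropositionalEquality
open ≡-Reasoning

sumBy : (State → ℕ) → List State → ℕ
sumBy g []       = 0
sumBy g (s ∷ ss) = g s + sumBy g ss

sumStates : ℕ → (State → ℕ) → ℕ
sumStates n g = sumBy g (allStates n)

countᵇ≡sumBy : ∀ (p : State → Bool) ss → countᵇ p ss ≡ sumBy (b2n ∘ p) ss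
countᵇ≡sumBy p []       = refl
countᵇ≡sumBy p (s ∷ ss) = cong (b2n (p s) +_) (countᵇ≡sumBy p ss)

sumBy-zero : ∀ ss → sumBy (λ _ → 0) ss ≡ 0
sumBy-zero []       = refl
sumBy-zero (s ∷ ss) = sumBy-zero ss

sumBy-*ˡ : ∀ c g ss → sumBy (λ s → c * g s) ss ≡ c * sumBy g ss
sumBy-*ˡ c g []       = sym (*-zeroʳ c)
sumBy-*ˡ c g (s ∷ ss) = trans (cong (c * g s +_) (sumBy-*ˡ c g ss)) (sym (*-distribˡ-+ c (g s) _))

sumBy-*ʳ : ∀ c g ss → sumBy (λ s → g s * c) ss ≡ sumBy g ss * c
sumBy-*ʳ c g []       = refl
sumBy-*ʳ c g (s ∷ ss) = trans (cong (g s * c +_) (sumBy-*ʳ c g ss)) (sym (*-distribʳ-+ c (g s) _))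

sumBy-doubled : ∀ g ss →
  sumBy g (concatMap (λ s → (true ∷ s) ∷ (false ∷ s) ∷ []) ss)
  ≡ sumBy (g ∘ (true ∷_)) ss + sumBy (g ∘ (false ∷_)) ss
sumBy-doubled g []       = refl
sumBy-doubled g (s ∷ ss) = begin
  g (true ∷ s) + (g (false ∷ s) + sumBy g (concatMap _ ss))
    ≡⟨ cong (λ r → g (true ∷ s) + (g (false ∷ s) + r)) (sumBy-doubled g ss) ⟩
  g (true ∷ s) + (g (false ∷ s) + (A + B))
    ≡⟨ +-assoc (g (true ∷ s)) (g (false ∷ s)) (A + B) ⟨
  (g (true ∷ s) + g (false ∷ s)) + (A + B)
    ≡⟨ interchange (g (true ∷ s)) (g (false ∷ s)) A B ⟩
  (g (true ∷ s) + A) + (g (false ∷ s) + B) ∎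
  where
  A B : ℕ
  A = sumBy (g ∘ (true ∷_)) ss
  B = sumBy (g ∘ (false ∷_)) ss

sumStates-suc : ∀ n g →
  sumStates (suc n) g ≡ sumStates n (g ∘ (true ∷_)) + sumStates n (g ∘ (false ∷_))
sumStates-suc n g = sumBy-doubled g (allStates n)

sumStates-cong : ∀ n {g h} → (∀ s → length s ≡ n → g s ≡ h s) → sumStates n g ≡ sumStates n h
sumStates-cong zero    g≗h = cong (_+ 0) (g≗h [] refl)
sumStates-cong (suc n) {g} {h} g≗h = begin
  sumStates (suc n) g
    ≡⟨ sumStates-suc n g ⟩
  sumStates n (g ∘ (true ∷_)) + sumStates n (g ∘ (false ∷_))
    ≡⟨ cong₂ _+_ (sumStates-cong n (λ s ∣s∣ → g≗h (true ∷ s) (cong suc ∣s∣)))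
                 (sumStates-cong n (λ s ∣s∣ → g≗h (false ∷ s) (cong suc ∣s∣))) ⟩
  sumStates n (h ∘ (true ∷_)) + sumStates n (h ∘ (false ∷_))
    ≡⟨ sumStates-suc n h ⟨
  sumStates (suc n) h ∎

sumStates-++ : ∀ m n g → sumStates (m + n) g ≡ sumStates m (λ p → sumStates n (g ∘ (p ++_)))
sumStates-++ zero    n g = sym (+-identityʳ _)
sumStates-++ (suc m) n g = begin
  sumStates (suc m + n) g
    ≡⟨ sumStates-suc (m + n) g ⟩
  sumStates (m + n) (g ∘ (true ∷_)) + sumStates (m + n) (g ∘ (false ∷_))
    ≡⟨ cong₂ _+_ (sumStates-++ m n (g ∘ (true ∷_))) (sumStates-++ m n (g ∘ (false ∷_))) ⟩
  _ ≡⟨ sumStates-suc m (λ p → sumStates n (g ∘ (p ++_))) ⟨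
  sumStates (suc m) (λ p → sumStates n (g ∘ (p ++_))) ∎

sumStates-++-* : ∀ m n {g f h} →
  (∀ p t → length p ≡ m → length t ≡ n → g (p ++ t) ≡ f p * h t) →
  sumStates (m + n) g ≡ sumStates m f * sumStates n h
sumStates-++-* m n {g} {f} {h} split = begin
  sumStates (m + n) g
    ≡⟨ sumStates-++ m n g ⟩
  sumStates m (λ p → sumStates n (g ∘ (p ++_)))
    ≡⟨ sumStates-cong m (λ p ∣p∣ → sumStates-cong n (λ t ∣t∣ → split p t ∣p∣ ∣t∣)) ⟩
  sumStates m (λ p → sumStates n (λ t → f p * h t))
    ≡⟨ sumStates-cong m (λ p _ → sumBy-*ˡ (f p) h (allStates n)) ⟩
  sumStates m (λ p → f p * sumStates n h)
    ≡⟨ sumBy-*ʳ (sumStates n h) f (allStates m) ⟩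
  sumStates m f * sumStates n h ∎

sumStates-fixHead : ∀ n a (p : State → Bool) →
  sumStates (suc n) (λ s → b2n ((at s 0 ==ᵇ a) ∧ p s)) ≡ sumStates n (λ t → b2n (p (a ∷ t)))
sumStates-fixHead n true  p = begin
  sumStates (suc n) (λ s → b2n ((at s 0 ==ᵇ true) ∧ p s))
    ≡⟨ sumStates-suc n _ ⟩
  sumStates n (λ t → b2n (p (true ∷ t))) + sumBy (λ _ → 0) (allStates n)
    ≡⟨ cong (sumStates n (λ t → b2n (p (true ∷ t))) +_) (sumBy-zero (allStates n)) ⟩
  sumStates n (λ t → b2n (p (true ∷ t))) + 0
    ≡⟨ +-identityʳ _ ⟩
  sumStates n (λ t → b2n (p (true ∷ t))) ∎
sumStates-fixHead n false p =
  trans (sumStates-suc n _) (cong (_+ sumStates n (λ t → b2n (p (false ∷ t)))) (sumBy-zero (allStates n)))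

at-++ˡ : ∀ p t {i} → i < length p → at (p ++ t) i ≡ at p i
at-++ˡ (b ∷ p) t {zero}  _         = refl
at-++ˡ (b ∷ p) t {suc i} (s≤s i<p) = at-++ˡ p t i<p

at-++ʳ : ∀ p t {m} → length p ≡ m → ∀ i → at (p ++ t) (m + i) ≡ at t i
at-++ʳ []      t refl i = refl
at-++ʳ (b ∷ p) t refl i = at-++ʳ p t refl i

b2n-∧ : ∀ a b → b2n (a ∧ b) ≡ b2n a * b2n b
b2n-∧ true  b = sym (+-identityʳ _)
b2n-∧ false b = refl

allᵇ-++ : ∀ {A : Set} (p : A → Bool) xs ys → allᵇ p (xs ++ ys) ≡ allᵇ p xs ∧ allᵇ p ys
allᵇ-++ p []       ys = refl
allᵇ-++ p (x ∷ xs) ys = trans (cong (p x ∧_) (allᵇ-++ p xs ys)) (sym (∧-assoc (p x) _ _))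

shiftBy : ℕ → (ℕ → Bool) → ℕ → Bool
shiftBy k σ i = σ (k + i)

-- σ colours the inner vertices, numbered in preorder from 0, as in facesFrom.
satisfies : Stack → Bool → Bool → Bool → (ℕ → Bool) → Bool
satisfies triangle x y z σ = isOne (b2n (x ==ᵇ y) + b2n (y ==ᵇ z) + b2n (z ==ᵇ x))
satisfies (insert d₁ d₂ d₃) x y z σ =
  satisfies d₁ x y (σ 0) (shiftBy 1 σ) ∧
  (satisfies d₂ y z (σ 0) (shiftBy (1 + inner d₁) σ) ∧
   satisfies d₃ z x (σ 0) (shiftBy (1 + inner d₁ + inner d₂) σ))

satisfies-local : ∀ d x y z σ τ → (∀ i → i < inner d → σ i ≡ τ i) →
  satisfies d x y z σ ≡ satisfies d x y z τ
satisfies-local triangle x y z σ τ agree = refl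
satisfies-local (insert d₁ d₂ d₃) x y z σ τ agree rewrite agree 0 (s≤s z≤n) =
  cong₂ _∧_
    (satisfies-local d₁ x y (τ 0) _ _ (λ i i< →
      agree (1 + i) (s≤s (m≤n⇒m≤n+o i₃ (m≤n⇒m≤n+o i₂ i<)))))
    (cong₂ _∧_
      (satisfies-local d₂ y z (τ 0) _ _ (λ i i< →
        agree (1 + i₁ + i) (s≤s (m≤n⇒m≤n+o i₃ (+-monoʳ-< i₁ i<)))))
      (satisfies-local d₃ z x (τ 0) _ _ (λ i i< →
        agree (1 + i₁ + i₂ + i) (s≤s (+-monoʳ-< (i₁ + i₂) i<)))))
  where
  i₁ i₂ i₃ : ℕ
  i₁ = inner d₁
  i₂ = inner d₂
  i₃ = inner d₃

satisfies-cong : ∀ d x y z {σ τ} → (∀ i → σ i ≡ τ i) → satisfies d x y z σ ≡ satisfies d x y z τ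
satisfies-cong d x y z σ≗τ = satisfies-local d x y z _ _ (λ i _ → σ≗τ i)

satisfies-++ˡ : ∀ d x y z p t → length p ≡ inner d →
  satisfies d x y z (at (p ++ t)) ≡ satisfies d x y z (at p)
satisfies-++ˡ d x y z p t ∣p∣ =
  satisfies-local d x y z _ _ (λ i i< → at-++ˡ p t (subst (i <_) (sym ∣p∣) i<))

facesFrom-satisfies : ∀ d a b c k s τ → (∀ i → τ i ≡ at s (k + i)) →
  allᵇ (λ f → isOne (nFrustrated s f)) (facesFrom d a b c k)
  ≡ satisfies d (at s a) (at s b) (at s c) τ
facesFrom-satisfies triangle a b c k s τ τ≗ = ∧-identityʳ _
facesFrom-satisfies (insert d₁ d₂ d₃) a b c k s τ τ≗
  rewrite trans (τ≗ 0) (cong (at s) (+-identityʳ k)) =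
  trans (allᵇ-++ P (facesFrom d₁ a b k (suc k)) _) (cong₂ _∧_
    (facesFrom-satisfies d₁ a b k (suc k) s _ (λ i →
      trans (τ≗ (1 + i)) (cong (at s) (+-suc k i))))
    (trans (allᵇ-++ P (facesFrom d₂ b c k (suc k + i₁)) _) (cong₂ _∧_
      (facesFrom-satisfies d₂ b c k (suc k + i₁) s _ (λ i →
        trans (τ≗ (1 + i₁ + i)) (cong (at s) (+-suc-assoc k i₁ i))))
      (facesFrom-satisfies d₃ c a k (suc k + i₁ + i₂) s _ (λ i →
        trans (τ≗ (1 + i₁ + i₂ + i)) (cong (at s)
          (trans (+-suc-assoc k (i₁ + i₂) i) (cong (_+ i) (sym (+-assoc (suc k) i₁ i₂))))))))))
  where
  P : Tri → Bool
  P f = isOne (nFrustrated s f)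
  +-suc-assoc : ∀ k j i → k + suc (j + i) ≡ suc k + j + i
  +-suc-assoc k j i = trans (+-suc k (j + i)) (cong suc (sym (+-assoc k j i)))
  i₁ i₂ : ℕ
  i₁ = inner d₁
  i₂ = inner d₂

nSatisfying : Stack → Bool → Bool → Bool → ℕ
nSatisfying d x y z = sumStates (inner d) (λ t → b2n (satisfies d x y z (at t)))

deg≡nSatisfying : ∀ Δ a b c → deg Δ a b c ≡ nSatisfying Δ a b c
deg≡nSatisfying Δ a b c = begin
  deg Δ a b c
    ≡⟨ countᵇ≡sumBy _ (allStates (nVerts Δ)) ⟩
  sumStates (3 + n) (λ s → b2n (satisfying Δ s ∧ ((at s 0 ==ᵇ a) ∧ ((at s 1 ==ᵇ b) ∧ (at s 2 ==ᵇ c)))))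
    ≡⟨ sumStates-cong (3 + n) (λ s _ → cong b2n
         (rotate (satisfying Δ s) (at s 0 ==ᵇ a) (at s 1 ==ᵇ b) (at s 2 ==ᵇ c))) ⟩
  sumStates (3 + n) (λ s → b2n ((at s 0 ==ᵇ a) ∧ ((at s 1 ==ᵇ b) ∧ ((at s 2 ==ᵇ c) ∧ satisfying Δ s))))
    ≡⟨ sumStates-fixHead (2 + n) a (λ s → (at s 1 ==ᵇ b) ∧ ((at s 2 ==ᵇ c) ∧ satisfying Δ s)) ⟩
  sumStates (2 + n) (λ s → b2n ((at s 0 ==ᵇ b) ∧ ((at s 1 ==ᵇ c) ∧ satisfying Δ (a ∷ s))))
    ≡⟨ sumStates-fixHead (1 + n) b (λ s → (at s 1 ==ᵇ c) ∧ satisfying Δ (a ∷ s)) ⟩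
  sumStates (1 + n) (λ s → b2n ((at s 0 ==ᵇ c) ∧ satisfying Δ (a ∷ b ∷ s)))
    ≡⟨ sumStates-fixHead n c (λ s → satisfying Δ (a ∷ b ∷ s)) ⟩
  sumStates n (λ t → b2n (satisfying Δ (a ∷ b ∷ c ∷ t)))
    ≡⟨ sumStates-cong n (λ t _ → cong b2n
         (facesFrom-satisfies Δ 0 1 2 3 (a ∷ b ∷ c ∷ t) (at t) (λ _ → refl))) ⟩
  nSatisfying Δ a b c ∎
  where
  n : ℕ
  n = inner Δ
  rotate : ∀ p q r s → p ∧ (q ∧ (r ∧ s)) ≡ q ∧ (r ∧ (s ∧ p))
  rotate p q r s = trans (∧-comm p _) (trans (∧-assoc q _ p) (cong (q ∧_) (∧-assoc r s p)))

nSatisfying-apex : ∀ d₁ d₂ d₃ x y z u →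
  sumStates (inner d₁ + inner d₂ + inner d₃) (λ t → b2n (satisfies (insert d₁ d₂ d₃) x y z (at (u ∷ t))))
  ≡ nSatisfying d₁ x y u * nSatisfying d₂ y z u * nSatisfying d₃ z x u
nSatisfying-apex d₁ d₂ d₃ x y z u = begin
  sumStates (i₁ + i₂ + i₃) g
    ≡⟨ cong (λ n → sumStates n g) (+-assoc i₁ i₂ i₃) ⟩
  sumStates (i₁ + (i₂ + i₃)) g
    ≡⟨ sumStates-++-* i₁ (i₂ + i₃) split₁ ⟩
  N₁ * sumStates (i₂ + i₃) h
    ≡⟨ cong (N₁ *_) (sumStates-++-* i₂ i₃ split₂) ⟩
  N₁ * (N₂ * N₃)
    ≡⟨ *-assoc N₁ N₂ N₃ ⟨
  N₁ * N₂ * N₃ ∎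
  where
  i₁ i₂ i₃ : ℕ
  i₁ = inner d₁
  i₂ = inner d₂
  i₃ = inner d₃
  N₁ N₂ N₃ : ℕ
  N₁ = nSatisfying d₁ x y u
  N₂ = nSatisfying d₂ y z u
  N₃ = nSatisfying d₃ z x u

  g h : State → ℕ
  g t = b2n (satisfies (insert d₁ d₂ d₃) x y z (at (u ∷ t)))
  h t = b2n (satisfies d₂ y z u (at t) ∧ satisfies d₃ z x u (shiftBy i₂ (at t)))

  split₁ : ∀ p t → length p ≡ i₁ → length t ≡ i₂ + i₃ →
    g (p ++ t) ≡ b2n (satisfies d₁ x y u (at p)) * h t
  split₁ p t ∣p∣ _ = trans (b2n-∧ (satisfies d₁ x y u (at (p ++ t))) _) (cong₂ _*_
    (cong b2n (satisfies-++ˡ d₁ x y u p t ∣p∣))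
    (cong b2n (cong₂ _∧_
      (satisfies-cong d₂ y z u (at-++ʳ p t ∣p∣))
      (satisfies-cong d₃ z x u (λ i → trans (cong (at (p ++ t)) (+-assoc i₁ i₂ i)) (at-++ʳ p t ∣p∣ (i₂ + i)))))))

  split₂ : ∀ q r → length q ≡ i₂ → length r ≡ i₃ →
    h (q ++ r) ≡ b2n (satisfies d₂ y z u (at q)) * b2n (satisfies d₃ z x u (at r))
  split₂ q r ∣q∣ _ = trans (b2n-∧ (satisfies d₂ y z u (at (q ++ r))) _) (cong₂ _*_
    (cong b2n (satisfies-++ˡ d₂ y z u q r ∣q∣))
    (cong b2n (satisfies-cong d₃ z x u (at-++ʳ q r ∣q∣))))

nSatisfying-insert : ∀ d₁ d₂ d₃ x y z →
  nSatisfying (insert d₁ d₂ d₃) x y z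
  ≡ nSatisfying d₁ x y true  * nSatisfying d₂ y z true  * nSatisfying d₃ z x true
  + nSatisfying d₁ x y false * nSatisfying d₂ y z false * nSatisfying d₃ z x false
nSatisfying-insert d₁ d₂ d₃ x y z =
  trans (sumStates-suc (inner d₁ + inner d₂ + inner d₃) _)
        (cong₂ _+_ (nSatisfying-apex d₁ d₂ d₃ x y z true) (nSatisfying-apex d₁ d₂ d₃ x y z false))

nSatisfying-not : ∀ d x y z → nSatisfying d (not x) (not y) (not z) ≡ nSatisfying d x y z
nSatisfying-not triangle true  true  true  = refl
nSatisfying-not triangle true  true  false = refl
nSatisfying-not triangle true  false true  = refl
nSatisfying-not triangle true  false false = refl
nSatisfying-not triangle false true  true  = refl
nSatisfying-not triangle false true  false = refl
nSatisfying-not triangle false false true  = refl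
nSatisfying-not triangle false false false = refl
nSatisfying-not (insert d₁ d₂ d₃) x y z = begin
  nSatisfying (insert d₁ d₂ d₃) (not x) (not y) (not z)
    ≡⟨ nSatisfying-insert d₁ d₂ d₃ (not x) (not y) (not z) ⟩
  N′ true + N′ false
    ≡⟨ cong₂ _+_ (flipped false) (flipped true) ⟩
  N false + N true
    ≡⟨ +-comm (N false) (N true) ⟩
  N true + N false
    ≡⟨ nSatisfying-insert d₁ d₂ d₃ x y z ⟨
  nSatisfying (insert d₁ d₂ d₃) x y z ∎
  where
  N N′ : Bool → ℕ
  N  u = nSatisfying d₁ x y u * nSatisfying d₂ y z u * nSatisfying d₃ z x u
  N′ u = nSatisfying d₁ (not x) (not y) u * nSatisfying d₂ (not y) (not z) u * nSatisfying d₃ (not z) (not x) u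
  flipped : ∀ u → N′ (not u) ≡ N u
  flipped u = cong₂ _*_ (cong₂ _*_ (nSatisfying-not d₁ x y u) (nSatisfying-not d₂ y z u))
                        (nSatisfying-not d₃ z x u)

quad-cong : ∀ {a b c d a′ b′ c′ d′} → a ≡ a′ → b ≡ b′ → c ≡ c′ → d ≡ d′ →
  ⟨ a , b , c , d ⟩ ≡ ⟨ a′ , b′ , c′ , d′ ⟩
quad-cong refl refl refl refl = refl

satVec : Stack → Quad
satVec d = ⟨ nSatisfying d true true true , nSatisfying d true true false
           , nSatisfying d true false true , nSatisfying d false true true ⟩

degVec≡satVec : ∀ Δ → degVec Δ ≡ satVec Δ
degVec≡satVec Δ = quad-cong (deg≡nSatisfying Δ true true true) (deg≡nSatisfying Δ true true false)
                            (deg≡nSatisfying Δ true false true) (deg≡nSatisfying Δ false true true)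

rule3 : Quad → Quad → Quad → Quad
rule3 ⟨ a₀ , a₁ , a₂ , a₃ ⟩ ⟨ b₀ , b₁ , b₂ , b₃ ⟩ ⟨ c₀ , c₁ , c₂ , c₃ ⟩ =
  ⟨ a₀ * b₀ * c₀ + a₁ * b₁ * c₁ , a₀ * b₂ * c₃ + a₁ * b₃ * c₂
  , a₂ * b₃ * c₀ + a₃ * b₂ * c₁ , a₂ * b₁ * c₃ + a₃ * b₀ * c₂ ⟩

satVec-insert : ∀ d₁ d₂ d₃ → satVec (insert d₁ d₂ d₃) ≡ rule3 (satVec d₁) (satVec d₂) (satVec d₃)
satVec-insert d₁ d₂ d₃ = quad-cong
  (nSatisfying-insert d₁ d₂ d₃ true true true)
  (trans (nSatisfying-insert d₁ d₂ d₃ true true false)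
    (cong (N₁ true true true * N₂ true false true * N₃ false true true +_)
      (cong₂ _*_ (cong (N₁ true true false *_) (nSatisfying-not d₂ false true true))
                 (nSatisfying-not d₃ true false true))))
  (trans (nSatisfying-insert d₁ d₂ d₃ true false true)
    (cong (N₁ true false true * N₂ false true true * N₃ true true true +_)
      (cong (_* N₃ true true false)
        (cong₂ _*_ (nSatisfying-not d₁ false true true) (nSatisfying-not d₂ true false true)))))
  (trans (nSatisfying-insert d₁ d₂ d₃ false true true)
    (trans (cong (N₁ false true true * N₂ true true true * N₃ true false true +_)
             (cong₂ _*_ (cong (_* N₂ true true false) (nSatisfying-not d₁ true false true))
                        (nSatisfying-not d₃ false true true)))
           (+-comm (N₁ false true true * N₂ true true true * N₃ true false true) _)))
  where
  N₁ N₂ N₃ : Bool → Bool → Bool → ℕ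
  N₁ = nSatisfying d₁
  N₂ = nSatisfying d₂
  N₃ = nSatisfying d₃

-- A missing child counts as a bare triangle, whose degeneracy vector is (0,1,1,1);
-- with this convention Rules 0–2 become instances of Rule 3.
childVec : Maybe CTree → Quad
childVec nothing  = ⟨ 0 , 1 , 1 , 1 ⟩
childVec (just t) = rootVec t

rule3-child₁ : ∀ a → rule3 a (childVec nothing) (childVec nothing) ≡ ⟨ q₁ a , q₀ a + q₁ a , q₃ a , q₂ a ⟩
rule3-child₁ ⟨ a₀ , a₁ , a₂ , a₃ ⟩ =
  quad-cong (solve (a₀ ∷ a₁ ∷ [])) (solve (a₀ ∷ a₁ ∷ [])) (solve (a₂ ∷ a₃ ∷ [])) (solve (a₂ ∷ a₃ ∷ []))

rule3-child₂ : ∀ a → rule3 (childVec nothing) a (childVec nothing) ≡ ⟨ q₁ a , q₃ a , q₂ a , q₀ a + q₁ a ⟩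
rule3-child₂ ⟨ a₀ , a₁ , a₂ , a₃ ⟩ =
  quad-cong (solve (a₀ ∷ a₁ ∷ [])) (solve (a₂ ∷ a₃ ∷ [])) (solve (a₂ ∷ a₃ ∷ [])) (solve (a₀ ∷ a₁ ∷ []))

rule3-child₃ : ∀ a → rule3 (childVec nothing) (childVec nothing) a ≡ ⟨ q₁ a , q₂ a , q₀ a + q₁ a , q₃ a ⟩
rule3-child₃ ⟨ a₀ , a₁ , a₂ , a₃ ⟩ =
  quad-cong (solve (a₀ ∷ a₁ ∷ [])) (solve (a₂ ∷ a₃ ∷ [])) (solve (a₀ ∷ a₁ ∷ [])) (solve (a₂ ∷ a₃ ∷ []))

rule3-children₁₂ : ∀ a b → rule3 a b (childVec nothing)
  ≡ ⟨ q₁ a * q₁ b , q₀ a * q₂ b + q₁ a * q₃ b , q₃ a * q₂ b , q₂ a * q₁ b + q₃ a * q₀ b ⟩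
rule3-children₁₂ ⟨ a₀ , a₁ , a₂ , a₃ ⟩ ⟨ b₀ , b₁ , b₂ , b₃ ⟩ = quad-cong
  (solve (a₀ ∷ a₁ ∷ b₀ ∷ b₁ ∷ [])) (solve (a₀ ∷ a₁ ∷ b₂ ∷ b₃ ∷ []))
  (solve (a₂ ∷ a₃ ∷ b₂ ∷ b₃ ∷ [])) (solve (a₂ ∷ a₃ ∷ b₀ ∷ b₁ ∷ []))

rule3-children₂₃ : ∀ a b → rule3 (childVec nothing) a b
  ≡ ⟨ q₁ a * q₁ b , q₃ a * q₂ b , q₃ a * q₀ b + q₂ a * q₁ b , q₁ a * q₃ b + q₀ a * q₂ b ⟩
rule3-children₂₃ ⟨ a₀ , a₁ , a₂ , a₃ ⟩ ⟨ b₀ , b₁ , b₂ , b₃ ⟩ = quad-cong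
  (solve (a₀ ∷ a₁ ∷ b₀ ∷ b₁ ∷ [])) (solve (a₂ ∷ a₃ ∷ b₂ ∷ b₃ ∷ []))
  (solve (a₂ ∷ a₃ ∷ b₀ ∷ b₁ ∷ [])) (solve (a₀ ∷ a₁ ∷ b₂ ∷ b₃ ∷ []))

rule3-children₃₁ : ∀ a b → rule3 b (childVec nothing) a
  ≡ ⟨ q₁ a * q₁ b , q₃ a * q₀ b + q₂ a * q₁ b , q₀ a * q₂ b + q₁ a * q₃ b , q₃ a * q₂ b ⟩
rule3-children₃₁ ⟨ a₀ , a₁ , a₂ , a₃ ⟩ ⟨ b₀ , b₁ , b₂ , b₃ ⟩ = quad-cong
  (solve (a₀ ∷ a₁ ∷ b₀ ∷ b₁ ∷ [])) (solve (a₂ ∷ a₃ ∷ b₀ ∷ b₁ ∷ []))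
  (solve (a₀ ∷ a₁ ∷ b₂ ∷ b₃ ∷ [])) (solve (a₂ ∷ a₃ ∷ b₂ ∷ b₃ ∷ []))

rootVec-node : ∀ m₁ m₂ m₃ → rootVec (node m₁ m₂ m₃) ≡ rule3 (childVec m₁) (childVec m₂) (childVec m₃)
rootVec-node nothing  nothing  nothing  = refl
rootVec-node (just a) nothing  nothing  = sym (rule3-child₁ (rootVec a))
rootVec-node nothing  (just a) nothing  = sym (rule3-child₂ (rootVec a))
rootVec-node nothing  nothing  (just a) = sym (rule3-child₃ (rootVec a))
rootVec-node (just a) (just b) nothing  = sym (rule3-children₁₂ (rootVec a) (rootVec b))
rootVec-node nothing  (just a) (just b) = sym (rule3-children₂₃ (rootVec a) (rootVec b))
rootVec-node (just b) nothing  (just a) = sym (rule3-children₃₁ (rootVec a) (rootVec b))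
rootVec-node (just a) (just b) (just c) = refl

childVec-T : ∀ Δ → childVec (T Δ) ≡ satVec Δ
childVec-T triangle          = refl
childVec-T (insert d₁ d₂ d₃) = begin
  rootVec (node (T d₁) (T d₂) (T d₃))
    ≡⟨ rootVec-node (T d₁) (T d₂) (T d₃) ⟩
  rule3 (childVec (T d₁)) (childVec (T d₂)) (childVec (T d₃))
    ≡⟨ cong₂ (λ a b → rule3 a b (childVec (T d₃))) (childVec-T d₁) (childVec-T d₂) ⟩
  rule3 (satVec d₁) (satVec d₂) (childVec (T d₃))
    ≡⟨ cong (rule3 (satVec d₁) (satVec d₂)) (childVec-T d₃) ⟩
  rule3 (satVec d₁) (satVec d₂) (satVec d₃)
    ≡⟨ satVec-insert d₁ d₂ d₃ ⟨
  satVec (insert d₁ d₂ d₃) ∎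

lemma7 : (Δ : Stack) → 4 ≤ nVerts Δ →
    Σ CTree (λ t → (T Δ ≡ just t) × (rootVec t ≡ degVec Δ))
lemma7 triangle (s≤s (s≤s (s≤s ())))
lemma7 Δ@(insert d₁ d₂ d₃) _ =
  node (T d₁) (T d₂) (T d₃) , refl , trans (childVec-T Δ) (sym (degVec≡satVec Δ))
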